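{- Let $q\ge 2$ be an integer and $\alpha\in[0,1)$. On the infinite $(q+1)$-regular tree $\mathbb{T}_{q+1}$, consider the simple random walk with laziness $\alpha$, and let $g(\ell,n)$ be the probability that the walk started at a vertex $u$ is at a given vertex $v$ with $\operatorname{dist}(u,v)=\ell$ after $n$ steps. Let $G(x,y)=\sum_{\ell,n\ge0}g(\ell,n)x^\ell y^n$ and $\gamma(y)=\sum_{n\ge 0}g(0,n)y^n$. Then, as formal power series, \[ \gamma(y) = q \left( \left( \tfrac{q-1}{2} \right) (1-\alpha y) + \sqrt{\Delta} \right)^{ -1}, \] \[ G(x,y) = \frac{\left( \frac{q+1}{2} \right) (1-\alpha y) + \sqrt{\Delta}}{\left( \frac{q+1}{2} \right) (1-\alpha y) - (1-\alpha)xy + \sqrt{\Delta}} \cdot q \left( \left( \tfrac{q-1}{2} \right) (1-\alpha y) + \sqrt{\Delta} \right)^{ -1}, \] where $\Delta = \left( \frac{q+1}{2} \right)^2 (1 - \alpha y)^2 - q(1-\alpha)^2 y^2$.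
   Context: The simple random walk with laziness $\alpha$: $p_0=u$, and at each step $p_{i+1}=p_i$ with probability $\alpha$ and $p_{i+1}=w$ with probability $\frac{1-\alpha}{q+1}$ for each neighbor $w$ of $p_i$. Here $\sqrt{\Delta}$ denotes the formal power series square root of $\Delta$ with constant term $\frac{q+1}{2}$.
   Formalization: The laziness α ranges over the rationals in [0,1) instead of the real numbers. -}

module Defs where

open import Data.Nat as ℕ using (ℕ; zero; suc; _∸_)
open import Data.Fin as Fin using (Fin)
open import Data.Fin.Properties as FinP using ()
open import Data.List using (List; []; _∷_; _++_; [_]; length; reverse; foldr; map)
open import Data.List.Properties using (≡-dec)
open import Data.Maybe using (Maybe; just; nothing)
open import Data.Integer using (+_)
open import Data.Rational using (ℚ; 0ℚ; 1ℚ; ½; _+_; _*_; _-_; -_; 1/_; ≢-nonZero)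
open import Data.Rational.Properties using (_≟_)
open import Data.Product using (_×_)
open import Data.Unit using (⊤)
open import Relation.Binary.PropositionalEquality using (_≡_; _≢_)
open import Relation.Nullary using (yes; no)

sum1 : {A : Set} → A → (A → A → A) → ℕ → (ℕ → A) → A
sum1 z add zero    f = z
sum1 z add (suc m) f = add (sum1 z add m f) (f (suc m))

at : {A : Set} → A → List A → ℕ → A
at d []       _       = d
at d (x ∷ xs) zero    = x
at d (x ∷ xs) (suc n) = at d xs n

module Series {A : Set} (0# 1# : A) (_⊕_ _⊗_ : A → A → A) (⊖_ : A → A) where

  PS : Set
  PS = ℕ → A

  const : A → PS
  const a zero    = a
  const a (suc _) = 0#

  X : PS
  X (suc zero) = 1#
  X _          = 0#

  _+ₛ_ : PS → PS → PS
  (f +ₛ g) n = f n ⊕ g n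

  negₛ : PS → PS
  negₛ f n = ⊖ f n

  _-ₛ_ : PS → PS → PS
  f -ₛ g = f +ₛ negₛ g

  _*ₛ_ : PS → PS → PS
  (f *ₛ g) n = (f 0 ⊗ g n) ⊕ sum1 0# _⊕_ n (λ k → f k ⊗ g (n ∸ k))

  -- Multiplicative inverse of f, given the inverse i0 of its constant term:
  -- b_0 = i0,  b_n = - i0 * Σ_{k=1}^{n} f_k b_{n-k}.
  invUpto : PS → A → ℕ → List A
  invUpto f i0 zero    = [ i0 ]
  invUpto f i0 (suc n) =
    let L = invUpto f i0 n in
    L ++ [ ⊖ (i0 ⊗ sum1 0# _⊕_ (suc n) (λ k → f k ⊗ at 0# L (suc n ∸ k))) ]

  invₛ : PS → A → PS
  invₛ f i0 n = at 0# (invUpto f i0 n) n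

-- total reciprocal (1/0 := 0; only used on nonzero arguments)
recip : ℚ → ℚ
recip p with p ≟ 0ℚ
... | yes _  = 0ℚ
... | no p≢0 = 1/_ p {{≢-nonZero p≢0}}

module Q = Series 0ℚ 1ℚ _+_ _*_ -_
open Q public using () renaming (PS to ℚ[[y]]; const to cst; X to Y;
  _+ₛ_ to _+Q_; _-ₛ_ to _-Q_; _*ₛ_ to _*Q_)

invQ : ℚ[[y]] → ℚ[[y]]
invQ f = Q.invₛ f (recip (f 0))

-- Square root of Δ with prescribed constant term c (c² = Δ₀, c ≠ 0):
-- s_0 = c,  s_{n+1} = (Δ_{n+1} - Σ_{k=1}^{n} s_k s_{n+1-k}) / (2c).
sqrtUpto : ℚ[[y]] → ℚ → ℕ → List ℚ
sqrtUpto Δ c zero    = [ c ]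
sqrtUpto Δ c (suc n) =
  let L = sqrtUpto Δ c n in
  L ++ [ (Δ (suc n) - sum1 0ℚ _+_ n (λ k → at 0ℚ L k * at 0ℚ L (suc n ∸ k)))
         * recip (c + c) ]

sqrtQ : ℚ[[y]] → ℚ → ℚ[[y]]
sqrtQ Δ c n = at 0ℚ (sqrtUpto Δ c n) n

-- Bivariate series ℚ[[y]][[x]] : coefficient of x^ℓ is a series in y.

module QQ = Series (cst 0ℚ) (cst 1ℚ) _+Q_ _*Q_ Q.negₛ

invQQ : QQ.PS → QQ.PS
invQQ f = QQ.invₛ f (invQ (f 0))

-- The infinite (q+1)-regular tree, realised as the Cayley graph of the
-- free product of q+1 copies of ℤ/2: vertices are reduced words in the
-- letters Fin (q+1) (no two consecutive equal letters).  A word is stored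
-- with its LAST letter at the head of the list; the root is [].

Vertex : ℕ → Set
Vertex q = List (Fin (suc q))

Reduced : {q : ℕ} → Vertex q → Set
Reduced []           = ⊤
Reduced (x ∷ [])     = ⊤
Reduced (x ∷ y ∷ ws) = (x ≢ y) × Reduced (y ∷ ws)

nbr : {q : ℕ} → Vertex q → Fin (suc q) → Vertex q
nbr []       i = i ∷ []
nbr (x ∷ ws) i with x Fin.≟ i
... | yes _ = ws
... | no  _ = i ∷ x ∷ ws

-- graph distance in the tree: remove the common initial segment of the
-- two words (their common ancestor path from the root)
distW : {q : ℕ} → Vertex q → Vertex q → ℕ
distW []       ys       = length ys
distW (x ∷ xs) []       = length (x ∷ xs)
distW (x ∷ xs) (y ∷ ys) with x Fin.≟ y
... | yes _ = distW xs ys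
... | no  _ = length (x ∷ xs) ℕ.+ length (y ∷ ys)

dist : {q : ℕ} → Vertex q → Vertex q → ℕ
dist u v = distW (reverse u) (reverse v)

ℕtoℚ : ℕ → ℚ
ℕtoℚ n = Data.Rational._/_ (+ n) 1

sumFin : (n : ℕ) → (Fin n → ℚ) → ℚ
sumFin zero    f = 0ℚ
sumFin (suc n) f = f Fin.zero + sumFin n (λ i → f (Fin.suc i))

indicator : {q : ℕ} → Vertex q → Vertex q → ℚ
indicator u v with ≡-dec Fin._≟_ u v
... | yes _ = 1ℚ
... | no  _ = 0ℚ

-- walkProb q α u v n = P_u(p_n = v), by first-step decomposition
walkProb : (q : ℕ) → ℚ → Vertex q → Vertex q → ℕ → ℚ
walkProb q α u v zero    = indicator u v
walkProb q α u v (suc n) =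
  α * walkProb q α u v n
  + ((1ℚ - α) * recip (ℕtoℚ (suc q)))
    * sumFin (suc q) (λ i → walkProb q α (nbr u i) v n)

oneMinusαy : ℚ → ℚ[[y]]
oneMinusαy α = cst 1ℚ -Q (cst α *Q Y)

Δ : ℕ → ℚ → ℚ[[y]]
Δ q α =
  (cst (((ℕtoℚ q + 1ℚ) * ½) * ((ℕtoℚ q + 1ℚ) * ½)) *Q (oneMinusαy α *Q oneMinusαy α))
  -Q (cst (ℕtoℚ q * ((1ℚ - α) * (1ℚ - α))) *Q (Y *Q Y))

sqrtΔ : ℕ → ℚ → ℚ[[y]]
sqrtΔ q α = sqrtQ (Δ q α) ((ℕtoℚ q + 1ℚ) * ½)

γRHS : ℕ → ℚ → ℚ[[y]]
γRHS q α =
  cst (ℕtoℚ q) *Q invQ ((cst ((ℕtoℚ q - 1ℚ) * ½) *Q oneMinusαy α) +Q sqrtΔ q α)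

numer : ℕ → ℚ → QQ.PS
numer q α = QQ.const ((cst ((ℕtoℚ q + 1ℚ) * ½) *Q oneMinusαy α) +Q sqrtΔ q α)

denom : ℕ → ℚ → QQ.PS
denom q α = QQ._-ₛ_ (numer q α) (QQ._*ₛ_ (QQ.const (cst (1ℚ - α) *Q Y)) QQ.X)

GRHS : ℕ → ℚ → QQ.PS
GRHS q α = QQ._*ₛ_ (QQ._*ₛ_ (numer q α) (invQQ (denom q α))) (QQ.const (γRHS q α))

coeffGRHS : ℕ → ℚ → ℕ → ℕ → ℚ
coeffGRHS q α ℓ n = GRHS q α ℓ n

{-# OPTIONS --safe #-}
module Submission where

-- The (q+1)-regular tree is the Cayley graph of the free product of q+1 copies of ℤ/2, so
-- P_u(p_n = v) depends only on ℓ = dist(u,v), the length of the reduced word u⁻¹v. Multiplying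
-- a nonempty reduced word on the left by a generator shortens it for exactly one generator and
-- lengthens it for the other q, so g is the unique solution of the first-step recurrence
--   g(0,n+1) = α g(0,n) + (1-α) g(1,n),
--   g(ℓ+1,n+1) = α g(ℓ+1,n) + (1-α)/(q+1) · (g(ℓ,n) + q g(ℓ+2,n)),   g(ℓ,0) = [ℓ = 0].
-- Put N = ((q+1)/2)(1-αy) + √Δ. The coefficient of x^ℓ in G is r^ℓ γ with r = (1-α)y/N, so the
-- recurrence reduces to two identities in ℚ[[y]],
--   (1-αy) r = (1-α)/(q+1) · y (1 + q r²)   and   (1-αy) γ = 1 + (1-α) y r γ,
-- and both follow from N² + q(1-α)²y² = (q+1)(1-αy) N, which is √Δ² = Δ rearranged.

open import Defs
open import Level using (0ℓ)
open import Algebra.Bundles using (CommutativeRing; CommutativeMonoid)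
open import Algebra.Structures using (IsCommutativeRing; IsAbelianGroup)
open import Data.Nat as ℕ using (ℕ; zero; suc; _∸_; _≤_; _<_; z≤n; s≤s)
import Data.Nat.Properties as ℕ
import Data.Nat.Coprimality as Coprime
import Data.Integer as ℤ
import Data.Integer.Properties as ℤ
open import Data.Rational as ℚ using (ℚ; 0ℚ; 1ℚ) renaming (_≤_ to _≤ℚ_; _<_ to _<ℚ_)
import Data.Rational.Properties as ℚ
open import Data.Rational.Solver using (module +-*-Solver)
open import Data.Fin as Fin using (Fin)
import Data.Fin.Properties as Fin
open import Data.List using (List; []; _∷_; _++_; [_]; length; reverse; _∷ʳ_; _ʳ++_)
import Data.List.Properties as List
open import Data.Product using (Σ; _×_; _,_; proj₁; proj₂)
open import Data.Sum using (inj₁; inj₂)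
open import Data.Unit using (⊤; tt)
open import Data.Empty using (⊥-elim)
open import Relation.Nullary using (yes; no)
open import Relation.Binary.Structures using (IsEquivalence)
open import Relation.Binary.PropositionalEquality as ≡ using (_≡_; _≢_)

module _ where
  open ≡ using (refl; cong₂)

  sum1-cong : ∀ {A : Set} (z : A) (add : A → A → A) m {f g : ℕ → A} →
              (∀ {k} → 1 ≤ k → k ≤ m → f k ≡ g k) → sum1 z add m f ≡ sum1 z add m g
  sum1-cong z add zero    f≡g = refl
  sum1-cong z add (suc m) f≡g =
    cong₂ add (sum1-cong z add m (λ 1≤k k≤m → f≡g 1≤k (ℕ.m≤n⇒m≤1+n k≤m)))
              (f≡g (s≤s z≤n) ℕ.≤-refl)

module Sum1Properties {ℓ} (M : CommutativeMonoid 0ℓ ℓ) where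
  open CommutativeMonoid M
  open import Relation.Binary.Reasoning.Setoid setoid

  sum1-unfoldˡ : ∀ m f → sum1 ε _∙_ (suc m) f ≈ f 1 ∙ sum1 ε _∙_ m (λ k → f (suc k))
  sum1-unfoldˡ zero    f = comm ε (f 1)
  sum1-unfoldˡ (suc m) f = begin
    sum1 ε _∙_ (suc m) f ∙ f (suc (suc m))                    ≈⟨ ∙-congʳ (sum1-unfoldˡ m f) ⟩
    (f 1 ∙ sum1 ε _∙_ m (λ k → f (suc k))) ∙ f (suc (suc m))  ≈⟨ assoc _ _ _ ⟩
    f 1 ∙ sum1 ε _∙_ (suc m) (λ k → f (suc k))                ∎

  sum1-ε : ∀ m f → (∀ k → f (suc k) ≈ ε) → sum1 ε _∙_ m f ≈ ε
  sum1-ε zero    f f≈ε = refl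
  sum1-ε (suc m) f f≈ε = trans (∙-cong (sum1-ε m f f≈ε) (f≈ε m)) (identityˡ ε)

module _ {A : Set} (d : A) where
  open ≡ using (refl)

  at-++-< : ∀ (xs : List A) x {k} → k < length xs → at d (xs ++ [ x ]) k ≡ at d xs k
  at-++-< (y ∷ ys) x {zero}  _         = refl
  at-++-< (y ∷ ys) x {suc k} (s≤s k<n) = at-++-< ys x k<n

  at-++-length : ∀ (xs : List A) x → at d (xs ++ [ x ]) (length xs) ≡ x
  at-++-length []       x = refl
  at-++-length (y ∷ ys) x = at-++-length ys x

module AppendOnly {A : Set} (d : A) (L : ℕ → List A) (L₀-length : length (L 0) ≡ 1)
                  (L-snoc : ∀ n → Σ A λ x → L (suc n) ≡ L n ++ [ x ]) where
  open ≡ using (refl; sym; trans; cong; subst)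

  private
    new : ℕ → A
    new n = proj₁ (L-snoc n)

  length-L : ∀ n → length (L n) ≡ suc n
  length-L zero    = L₀-length
  length-L (suc n) rewrite proj₂ (L-snoc n) | List.length-++ (L n) {[ new n ]} | length-L n =
    cong suc (ℕ.+-comm n 1)

  at-L-last : ∀ n → at d (L (suc n)) (suc n) ≡ new n
  at-L-last n rewrite proj₂ (L-snoc n) =
    subst (λ m → at d (L n ++ [ new n ]) m ≡ new n) (length-L n) (at-++-length d (L n) (new n))

  at-L-stable : ∀ {k n} → k ≤ n → at d (L n) k ≡ at d (L k) k
  at-L-stable {n = zero} z≤n = refl
  at-L-stable {k} {suc n} k≤1+n with ℕ.m≤n⇒m<n∨m≡n k≤1+n
  ... | inj₂ refl        = refl
  ... | inj₁ (s≤s k≤n) = trans extend (at-L-stable k≤n)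
    where
    extend : at d (L (suc n)) k ≡ at d (L n) k
    extend rewrite proj₂ (L-snoc n) =
      at-++-< d (L n) (new n) (subst (k <_) (sym (length-L n)) (s≤s k≤n))

module PowerSeries {ℓ} (R : CommutativeRing 0ℓ ℓ) where
  open CommutativeRing R
  open import Relation.Binary.Reasoning.Setoid setoid
  open import Algebra.Properties.Ring ring using (-‿distribˡ-*; -‿distribʳ-*; -‿involutive; -0#≈0#)
  open import Algebra.Properties.CommutativeSemigroup +-commutativeSemigroup using (interchange)
  open import Algebra.Solver.Ring.NaturalCoefficients.Default commutativeSemiring
    using (solve; _:=_; _:+_; _:*_)
  open Sum1Properties +-commutativeMonoid
  open Series 0# 1# _+_ _*_ -_ public

  infix 4 _≋_
  record _≋_ (f g : PS) : Set ℓ where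
    constructor mk≋
    field coeff≈ : ∀ n → f n ≈ g n
  open _≋_ public

  const-0 : ∀ n → const 0# n ≈ 0#
  const-0 zero    = refl
  const-0 (suc n) = refl

  shift : PS → PS
  shift f n = f (suc n)

  -- The Cauchy product unfolded along its first factor, with no finite sum left;
  -- the ring laws are proved for this form and transported along *ₛ≈mul.
  mul : PS → PS → PS
  mul f g zero    = f 0 * g 0
  mul f g (suc n) = f 0 * g (suc n) + mul (shift f) g n

  *ₛ≈mul : ∀ f g n → (f *ₛ g) n ≈ mul f g n
  *ₛ≈mul f g zero    = +-identityʳ (f 0 * g 0)
  *ₛ≈mul f g (suc n) = +-congˡ (trans (sum1-unfoldˡ n (λ k → f k * g (suc n ∸ k))) (*ₛ≈mul (shift f) g n))

  mul-cong : ∀ {f f' g g'} → (∀ k → f k ≈ f' k) → (∀ k → g k ≈ g' k) → ∀ n → mul f g n ≈ mul f' g' n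
  mul-cong f≈ g≈ zero    = *-cong (f≈ 0) (g≈ 0)
  mul-cong f≈ g≈ (suc n) = +-cong (*-cong (f≈ 0) (g≈ (suc n))) (mul-cong (λ k → f≈ (suc k)) g≈ n)

  mul-distribˡ : ∀ f g h n → mul f (g +ₛ h) n ≈ mul f g n + mul f h n
  mul-distribˡ f g h zero    = distribˡ (f 0) (g 0) (h 0)
  mul-distribˡ f g h (suc n) = trans (+-cong (distribˡ (f 0) (g (suc n)) (h (suc n))) (mul-distribˡ (shift f) g h n))
                                     (interchange _ _ _ _)

  mul-distribʳ : ∀ f g h n → mul (f +ₛ g) h n ≈ mul f h n + mul g h n
  mul-distribʳ f g h zero    = distribʳ (h 0) (f 0) (g 0)
  mul-distribʳ f g h (suc n) = trans (+-cong (distribʳ (h (suc n)) (f 0) (g 0)) (mul-distribʳ (shift f) (shift g) h n))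
                                     (interchange _ _ _ _)

  mul-zeroˡ : ∀ g n → mul (λ _ → 0#) g n ≈ 0#
  mul-zeroˡ g zero    = zeroˡ (g 0)
  mul-zeroˡ g (suc n) = trans (+-cong (zeroˡ (g (suc n))) (mul-zeroˡ g n)) (+-identityˡ 0#)

  mul-constˡ : ∀ x g n → mul (const x) g n ≈ x * g n
  mul-constˡ x g zero    = refl
  mul-constˡ x g (suc n) = trans (+-congˡ (mul-zeroˡ g n)) (+-identityʳ _)

  mul-scaleˡ : ∀ x f g n → mul (λ k → x * f k) g n ≈ x * mul f g n
  mul-scaleˡ x f g zero    = *-assoc x (f 0) (g 0)
  mul-scaleˡ x f g (suc n) = trans (+-cong (*-assoc x (f 0) (g (suc n))) (mul-scaleˡ x (shift f) g n))
                                   (sym (distribˡ x _ _))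

  mul-assoc : ∀ f g h n → mul (mul f g) h n ≈ mul f (mul g h) n
  mul-assoc f g h zero    = *-assoc (f 0) (g 0) (h 0)
  mul-assoc f g h (suc n) = begin
    (f 0 * g 0) * h (suc n) + mul (shift (mul f g)) h n
      ≈⟨ +-congˡ (mul-distribʳ (λ k → f 0 * g (suc k)) (mul (shift f) g) h n) ⟩
    (f 0 * g 0) * h (suc n) + (mul (λ k → f 0 * g (suc k)) h n + mul (mul (shift f) g) h n)
      ≈⟨ +-congˡ (+-cong (mul-scaleˡ (f 0) (shift g) h n) (mul-assoc (shift f) g h n)) ⟩
    (f 0 * g 0) * h (suc n) + (f 0 * mul (shift g) h n + mul (shift f) (mul g h) n)
      ≈⟨ solve 5 (λ a b c d e → (a :* b) :* c :+ (a :* d :+ e) := a :* (b :* c :+ d) :+ e) refl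
               (f 0) (g 0) (h (suc n)) (mul (shift g) h n) (mul (shift f) (mul g h) n) ⟩
    f 0 * (g 0 * h (suc n) + mul (shift g) h n) + mul (shift f) (mul g h) n
      ∎

  mul-comm : ∀ f g n → mul f g n ≈ mul g f n
  mul-comm f g zero          = *-comm (f 0) (g 0)
  mul-comm f g (suc zero)    = trans (+-congˡ (mul-comm (shift f) g 0))
    (trans (+-comm _ _) (+-congˡ (mul-comm f (shift g) 0)))
  mul-comm f g (suc (suc n)) = begin
    f 0 * g (2 ℕ.+ n) + mul (shift f) g (suc n)
      ≈⟨ +-congˡ (mul-comm (shift f) g (suc n)) ⟩
    f 0 * g (2 ℕ.+ n) + (g 0 * f (2 ℕ.+ n) + mul (shift g) (shift f) n)
      ≈⟨ solve 3 (λ a b c → a :+ (b :+ c) := b :+ (a :+ c)) refl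
               (f 0 * g (2 ℕ.+ n)) (g 0 * f (2 ℕ.+ n)) (mul (shift g) (shift f) n) ⟩
    g 0 * f (2 ℕ.+ n) + (f 0 * g (2 ℕ.+ n) + mul (shift g) (shift f) n)
      ≈⟨ +-congˡ (+-congˡ (mul-comm (shift g) (shift f) n)) ⟩
    g 0 * f (2 ℕ.+ n) + mul f (shift g) (suc n)
      ≈⟨ +-congˡ (mul-comm f (shift g) (suc n)) ⟩
    g 0 * f (2 ℕ.+ n) + mul (shift g) f (suc n)
      ∎

  *ₛ-cong : ∀ {f f' g g'} → f ≋ f' → g ≋ g' → f *ₛ g ≋ f' *ₛ g'
  *ₛ-cong {f} {f'} {g} {g'} f≋f' g≋g' = mk≋ λ n → begin
    (f *ₛ g) n     ≈⟨ *ₛ≈mul f g n ⟩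
    mul f g n      ≈⟨ mul-cong (coeff≈ f≋f') (coeff≈ g≋g') n ⟩
    mul f' g' n    ≈⟨ *ₛ≈mul f' g' n ⟨
    (f' *ₛ g') n   ∎

  *ₛ-assoc : ∀ f g h → (f *ₛ g) *ₛ h ≋ f *ₛ (g *ₛ h)
  *ₛ-assoc f g h = mk≋ λ n → begin
    ((f *ₛ g) *ₛ h) n   ≈⟨ *ₛ≈mul (f *ₛ g) h n ⟩
    mul (f *ₛ g) h n    ≈⟨ mul-cong (*ₛ≈mul f g) (λ _ → refl) n ⟩
    mul (mul f g) h n   ≈⟨ mul-assoc f g h n ⟩
    mul f (mul g h) n   ≈⟨ mul-cong (λ _ → refl) (*ₛ≈mul g h) n ⟨
    mul f (g *ₛ h) n    ≈⟨ *ₛ≈mul f (g *ₛ h) n ⟨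
    (f *ₛ (g *ₛ h)) n   ∎

  *ₛ-comm : ∀ f g → f *ₛ g ≋ g *ₛ f
  *ₛ-comm f g = mk≋ λ n → trans (*ₛ≈mul f g n) (trans (mul-comm f g n) (sym (*ₛ≈mul g f n)))

  coeff-const*ₛ : ∀ x g n → (const x *ₛ g) n ≈ x * g n
  coeff-const*ₛ x g n = trans (*ₛ≈mul (const x) g n) (mul-constˡ x g n)

  *ₛ-identityˡ : ∀ g → const 1# *ₛ g ≋ g
  *ₛ-identityˡ g = mk≋ λ n → trans (coeff-const*ₛ 1# g n) (*-identityˡ (g n))

  *ₛ-distribˡ : ∀ f g h → f *ₛ (g +ₛ h) ≋ (f *ₛ g) +ₛ (f *ₛ h)
  *ₛ-distribˡ f g h = mk≋ λ n → trans (*ₛ≈mul f (g +ₛ h) n)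
    (trans (mul-distribˡ f g h n) (sym (+-cong (*ₛ≈mul f g n) (*ₛ≈mul f h n))))

  *ₛ-distribʳ : ∀ h f g → (f +ₛ g) *ₛ h ≋ (f *ₛ h) +ₛ (g *ₛ h)
  *ₛ-distribʳ h f g = mk≋ λ n → trans (*ₛ≈mul (f +ₛ g) h n)
    (trans (mul-distribʳ f g h n) (sym (+-cong (*ₛ≈mul f h n) (*ₛ≈mul g h n))))

  ≋-isEquivalence : IsEquivalence _≋_
  ≋-isEquivalence = record
    { refl  = mk≋ λ _ → refl
    ; sym   = λ f≋g → mk≋ λ n → sym (coeff≈ f≋g n)
    ; trans = λ f≋g g≋h → mk≋ λ n → trans (coeff≈ f≋g n) (coeff≈ g≋h n)
    }

  +ₛ-isAbelianGroup : IsAbelianGroup _≋_ _+ₛ_ (const 0#) negₛ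
  +ₛ-isAbelianGroup = record
    { isGroup = record
      { isMonoid = record
        { isSemigroup = record
          { isMagma = record
            { isEquivalence = ≋-isEquivalence
            ; ∙-cong = λ f≋f' g≋g' → mk≋ λ n → +-cong (coeff≈ f≋f' n) (coeff≈ g≋g' n)
            }
          ; assoc = λ f g h → mk≋ λ n → +-assoc (f n) (g n) (h n)
          }
        ; identity = (λ f → mk≋ λ n → trans (+-congʳ (const-0 n)) (+-identityˡ (f n)))
                   , (λ f → mk≋ λ n → trans (+-congˡ (const-0 n)) (+-identityʳ (f n)))
        }
      ; inverse = (λ f → mk≋ λ n → trans (-‿inverseˡ (f n)) (sym (const-0 n)))
                , (λ f → mk≋ λ n → trans (-‿inverseʳ (f n)) (sym (const-0 n)))
      ; ⁻¹-cong = λ f≋g → mk≋ λ n → -‿cong (coeff≈ f≋g n)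
      }
    ; comm = λ f g → mk≋ λ n → +-comm (f n) (g n)
    }

  series-isCommutativeRing : IsCommutativeRing _≋_ _+ₛ_ _*ₛ_ negₛ (const 0#) (const 1#)
  series-isCommutativeRing = record
    { isRing = record
      { +-isAbelianGroup = +ₛ-isAbelianGroup
      ; *-cong     = *ₛ-cong
      ; *-assoc    = *ₛ-assoc
      ; *-identity = *ₛ-identityˡ
                   , λ g → IsEquivalence.trans ≋-isEquivalence (*ₛ-comm g (const 1#)) (*ₛ-identityˡ g)
      ; distrib    = *ₛ-distribˡ , *ₛ-distribʳ
      }
    ; *-comm = *ₛ-comm
    }

  seriesRing : CommutativeRing 0ℓ ℓ
  seriesRing = record { isCommutativeRing = series-isCommutativeRing }

  const-+ : ∀ x y → const (x + y) ≋ const x +ₛ const y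
  const-+ x y = mk≋ λ where
    zero    → refl
    (suc n) → sym (+-identityˡ 0#)

  const-* : ∀ x y → const (x * y) ≋ const x *ₛ const y
  const-* x y = mk≋ λ n → sym (trans (coeff-const*ₛ x (const y) n) (x*const n))
    where
    x*const : ∀ n → x * const y n ≈ const (x * y) n
    x*const zero    = refl
    x*const (suc n) = zeroʳ x

  coeff-X*ₛ-zero : ∀ f → (X *ₛ f) 0 ≈ 0#
  coeff-X*ₛ-zero f = trans (+-identityʳ _) (zeroˡ (f 0))

  coeff-X*ₛ-suc : ∀ f n → (X *ₛ f) (suc n) ≈ f n
  coeff-X*ₛ-suc f n = begin
    (X *ₛ f) (suc n)                    ≈⟨ *ₛ≈mul X f (suc n) ⟩
    0# * f (suc n) + mul (shift X) f n  ≈⟨ +-cong (zeroˡ _) (mul-cong shift-X (λ _ → refl) n) ⟩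
    0# + mul (const 1#) f n             ≈⟨ +-identityˡ _ ⟩
    mul (const 1#) f n                  ≈⟨ mul-constˡ 1# f n ⟩
    1# * f n                            ≈⟨ *-identityˡ (f n) ⟩
    f n                                 ∎
    where
    shift-X : ∀ k → shift X k ≈ const 1# k
    shift-X zero    = refl
    shift-X (suc k) = refl

  module _ (f : PS) (i : Carrier) where
    open AppendOnly 0# (invUpto f i) ≡.refl (λ n → _ , ≡.refl)

    invₛ-suc : ∀ n → invₛ f i (suc n) ≡ - (i * sum1 0# _+_ (suc n) (λ k → f k * invₛ f i (suc n ∸ k)))
    invₛ-suc n = ≡.trans (at-L-last n) (≡.cong (λ t → - (i * t)) (sum1-cong 0# _+_ (suc n) earlier))
      where
      earlier : ∀ {k} → 1 ≤ k → k ≤ suc n →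
                f k * at 0# (invUpto f i n) (suc n ∸ k) ≡ f k * invₛ f i (suc n ∸ k)
      earlier {suc k} _ _ = ≡.cong (f (suc k) *_) (at-L-stable (ℕ.m∸n≤m n k))

    *ₛ-invₛ : i * f 0 ≈ 1# → f *ₛ invₛ f i ≋ const 1#
    *ₛ-invₛ i*f₀≈1 = mk≋ λ where
      zero → begin
        f 0 * i + 0#  ≈⟨ +-identityʳ _ ⟩
        f 0 * i       ≈⟨ *-comm _ _ ⟩
        i * f 0       ≈⟨ i*f₀≈1 ⟩
        1#            ∎
      (suc n) → let S = sum1 0# _+_ (suc n) (λ k → f k * invₛ f i (suc n ∸ k)) in begin
        f 0 * invₛ f i (suc n) + S  ≡⟨ ≡.cong (λ t → f 0 * t + S) (invₛ-suc n) ⟩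
        f 0 * - (i * S) + S         ≈⟨ +-congʳ (sym (-‿distribʳ-* (f 0) (i * S))) ⟩
        - (f 0 * (i * S)) + S
          ≈⟨ +-congʳ (-‿cong (solve 3 (λ a b c → a :* (b :* c) := (b :* a) :* c) refl (f 0) i S)) ⟩
        - ((i * f 0) * S) + S       ≈⟨ +-congʳ (-‿cong (trans (*-congʳ i*f₀≈1) (*-identityˡ S))) ⟩
        - S + S                     ≈⟨ -‿inverseˡ S ⟩
        0#                          ∎

  linear : Carrier → Carrier → PS
  linear h e = const h -ₛ (const e *ₛ X)

  module _ (h e : Carrier) where

    linear-coeff₀ : linear h e 0 ≈ h
    linear-coeff₀ = begin
      h + - ((const e *ₛ X) 0)  ≈⟨ +-congˡ (-‿cong (trans (coeff-const*ₛ e X 0) (zeroʳ e))) ⟩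
      h + - 0#                  ≈⟨ +-congˡ -0#≈0# ⟩
      h + 0#                    ≈⟨ +-identityʳ h ⟩
      h                         ∎

    invₛ-linear-suc : ∀ i n → invₛ (linear h e) i (suc n) ≈ i * (e * invₛ (linear h e) i n)
    invₛ-linear-suc i n = begin
      b (suc n)             ≡⟨ invₛ-suc (linear h e) i n ⟩
      - (i * S)             ≈⟨ -‿cong (*-congˡ S≈-eb) ⟩
      - (i * (- e * b n))   ≈⟨ -‿cong (*-congˡ (sym (-‿distribˡ-* e (b n)))) ⟩
      - (i * - (e * b n))   ≈⟨ -‿cong (sym (-‿distribʳ-* i _)) ⟩
      - - (i * (e * b n))   ≈⟨ -‿involutive _ ⟩
      i * (e * b n)         ∎
      where
      f b : PS
      f = linear h e
      b = invₛ f i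
      S : Carrier
      S = sum1 0# _+_ (suc n) (λ k → f k * b (suc n ∸ k))

      f-suc : ∀ k → f (suc k) ≈ - (e * X (suc k))
      f-suc k = trans (+-identityˡ _) (-‿cong (coeff-const*ₛ e X (suc k)))

      S≈-eb : S ≈ - e * b n
      S≈-eb = begin
        S                                                          ≈⟨ sum1-unfoldˡ n _ ⟩
        f 1 * b n + sum1 0# _+_ n (λ k → f (suc k) * b (n ∸ k))
          ≈⟨ +-cong (*-congʳ (trans (f-suc 0) (-‿cong (*-identityʳ e))))
                    (sum1-ε n _ (λ k → trans (*-congʳ (trans (f-suc (suc k)) (trans (-‿cong (zeroʳ e)) -0#≈0#)))
                                             (zeroˡ _))) ⟩
        - e * b n + 0#                                             ≈⟨ +-identityʳ _ ⟩
        - e * b n                                                  ∎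

module _ {ℓ₁ ℓ₂} (R : CommutativeRing ℓ₁ ℓ₂) where
  open CommutativeRing R
  open import Relation.Binary.Reasoning.Setoid setoid

  *-cancelʳ-invertible : ∀ {u v} → v * u ≈ 1# → ∀ {x z} → x * u ≈ z * u → x ≈ z
  *-cancelʳ-invertible {u} {v} vu≈1 {x} {z} xu≈zu = begin
    x             ≈⟨ *-identityʳ x ⟨
    x * 1#        ≈⟨ *-congˡ vu≈1 ⟨
    x * (v * u)   ≈⟨ x∙yz≈xz∙y x v u ⟩
    (x * u) * v   ≈⟨ *-congʳ xu≈zu ⟩
    (z * u) * v   ≈⟨ x∙yz≈xz∙y z v u ⟨
    z * (v * u)   ≈⟨ *-congˡ vu≈1 ⟩
    z * 1#        ≈⟨ *-identityʳ z ⟩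
    z             ∎
    where open import Algebra.Properties.CommutativeSemigroup *-commutativeSemigroup using (x∙yz≈xz∙y)

module LazyWalkGeneratingFunction {ℓ₁ ℓ₂} (R : CommutativeRing ℓ₁ ℓ₂) where
  open CommutativeRing R
  open import Relation.Binary.Reasoning.Setoid setoid
  open import Algebra.Properties.Ring ring using (+-cancelʳ)
  open import Algebra.Solver.Ring.NaturalCoefficients.Default commutativeSemiring
    using (solve; _:=_; _:+_; _:*_; con)

  -- Intended reading: y the indeterminate, A = 1 - αy, a = (q+1)/2, c = 1 - α, β = c/(q+1),
  -- s = √Δ, N = aA + s, D = N - A, i = N⁻¹, j = D⁻¹. Then γ = qD⁻¹, and r = cy/N is the ratio
  -- of consecutive x-coefficients of G.
  module Identities
    (q a c α β y A s D i j : Carrier)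
    (A+αy≈1        : A + α * y ≈ 1#)
    (a+a≈q+1       : a + a ≈ q + 1#)
    (β[q+1]≈c      : β * (q + 1#) ≈ c)
    (s²+qc²y²≈a²A² : s * s + q * (c * c) * (y * y) ≈ (a * a) * (A * A))
    (D+A≈N         : D + A ≈ a * A + s)
    (iN≈1          : i * (a * A + s) ≈ 1#)
    (jD≈1          : j * D ≈ 1#)
    where

    N : Carrier
    N = a * A + s

    N²+qc²y²≈[q+1]AN : N * N + q * (c * c) * (y * y) ≈ (q + 1#) * A * N
    N²+qc²y²≈[q+1]AN = +-cancelʳ ((a * a) * (A * A)) _ _ (begin
      N * N + q * (c * c) * (y * y) + (a * a) * (A * A)
        ≈⟨ solve 6 (λ q a c y A s →
             (a :* A :+ s) :* (a :* A :+ s) :+ q :* (c :* c) :* (y :* y) :+ (a :* a) :* (A :* A)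
             := (a :+ a) :* A :* (a :* A :+ s) :+ (s :* s :+ q :* (c :* c) :* (y :* y)))
             refl q a c y A s ⟩
      (a + a) * A * N + (s * s + q * (c * c) * (y * y))
        ≈⟨ +-cong (*-congʳ (*-congʳ a+a≈q+1)) s²+qc²y²≈a²A² ⟩
      (q + 1#) * A * N + (a * a) * (A * A)
        ∎)

    r : Carrier
    r = i * (c * y)

    rN≈cy : r * N ≈ c * y
    rN≈cy = begin
      i * (c * y) * N   ≈⟨ solve 4 (λ i c y N → i :* (c :* y) :* N := (i :* N) :* (c :* y)) refl i c y N ⟩
      (i * N) * (c * y) ≈⟨ *-congʳ iN≈1 ⟩
      1# * (c * y)      ≈⟨ *-identityˡ _ ⟩
      c * y             ∎

    Ar≈βy[1+qr²] : A * r ≈ β * y * (1# + q * (r * r))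
    Ar≈βy[1+qr²] = cancel-N (cancel-N (begin
      A * r * N * N
        ≈⟨ solve 3 (λ A r N → A :* r :* N :* N := A :* (r :* N) :* N) refl A r N ⟩
      A * (r * N) * N
        ≈⟨ *-congʳ (*-congˡ rN≈cy) ⟩
      A * (c * y) * N
        ≈⟨ solve 4 (λ A c y N → A :* (c :* y) :* N := c :* (y :* A :* N)) refl A c y N ⟩
      c * (y * A * N)
        ≈⟨ *-congʳ β[q+1]≈c ⟨
      β * (q + 1#) * (y * A * N)
        ≈⟨ solve 5 (λ β q y A N → β :* (q :+ con 1) :* (y :* A :* N)
                                  := β :* y :* ((q :+ con 1) :* A :* N)) refl β q y A N ⟩
      β * y * ((q + 1#) * A * N)
        ≈⟨ *-congˡ N²+qc²y²≈[q+1]AN ⟨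
      β * y * (N * N + q * (c * c) * (y * y))
        ≈⟨ *-congˡ (+-congˡ (solve 3 (λ q c y → q :* (c :* c) :* (y :* y) := q :* ((c :* y) :* (c :* y)))
                                     refl q c y)) ⟩
      β * y * (N * N + q * ((c * y) * (c * y)))
        ≈⟨ *-congˡ (+-congˡ (*-congˡ (*-cong rN≈cy rN≈cy))) ⟨
      β * y * (N * N + q * ((r * N) * (r * N)))
        ≈⟨ solve 5 (λ β y N q r → β :* y :* (N :* N :+ q :* ((r :* N) :* (r :* N)))
                                  := β :* y :* (con 1 :+ q :* (r :* r)) :* N :* N) refl β y N q r ⟩
      β * y * (1# + q * (r * r)) * N * N
        ∎))
      where
      cancel-N : ∀ {x z} → x * N ≈ z * N → x ≈ z
      cancel-N = *-cancelʳ-invertible R iN≈1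

    γ : Carrier
    γ = q * j

    DN+qc²y²≈qAN : D * N + q * (c * c) * (y * y) ≈ q * A * N
    DN+qc²y²≈qAN = +-cancelʳ (A * N) _ _ (begin
      D * N + q * (c * c) * (y * y) + A * N
        ≈⟨ solve 6 (λ D N q c y A → D :* N :+ q :* (c :* c) :* (y :* y) :+ A :* N
                                    := (D :+ A) :* N :+ q :* (c :* c) :* (y :* y)) refl D N q c y A ⟩
      (D + A) * N + q * (c * c) * (y * y)
        ≈⟨ +-congʳ (*-congʳ D+A≈N) ⟩
      N * N + q * (c * c) * (y * y)
        ≈⟨ N²+qc²y²≈[q+1]AN ⟩
      (q + 1#) * A * N
        ≈⟨ solve 3 (λ q A N → (q :+ con 1) :* A :* N := q :* A :* N :+ A :* N) refl q A N ⟩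
      q * A * N + A * N
        ∎)

    Aγ≈1+cyrγ : A * γ ≈ 1# + c * y * (r * γ)
    Aγ≈1+cyrγ = *-cancelʳ-invertible R jD≈1 (*-cancelʳ-invertible R iN≈1 (begin
      A * (q * j) * D * N
        ≈⟨ solve 5 (λ A q j D N → A :* (q :* j) :* D :* N := q :* A :* N :* (j :* D)) refl A q j D N ⟩
      q * A * N * (j * D)
        ≈⟨ *-congˡ jD≈1 ⟩
      q * A * N * 1#
        ≈⟨ *-identityʳ _ ⟩
      q * A * N
        ≈⟨ DN+qc²y²≈qAN ⟨
      D * N + q * (c * c) * (y * y)
        ≈⟨ solve 5 (λ D N q c y → D :* N :+ q :* (c :* c) :* (y :* y)
                                  := D :* N :+ c :* y :* (c :* y) :* q :* con 1) refl D N q c y ⟩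
      D * N + c * y * (c * y) * q * 1#
        ≈⟨ +-congˡ (*-cong (*-congʳ (*-congˡ rN≈cy)) jD≈1) ⟨
      D * N + c * y * (r * N) * q * (j * D)
        ≈⟨ solve 7 (λ D N c y r q j → D :* N :+ c :* y :* (r :* N) :* q :* (j :* D)
                                         := (con 1 :+ c :* y :* (r :* (q :* j))) :* D :* N) refl D N c y r q j ⟩
      (1# + c * y * (r * (q * j))) * D * N
        ∎))

    module _ (ρ : ℕ → Carrier) (ρ₀≈γ : ρ 0 ≈ γ) (ρ-suc : ∀ ℓ → ρ (suc ℓ) ≈ r * ρ ℓ) where

      x≈Ax+αyx : ∀ x → x ≈ A * x + α * (y * x)
      x≈Ax+αyx x = begin
        x                   ≈⟨ *-identityˡ x ⟨
        1# * x              ≈⟨ *-congʳ A+αy≈1 ⟨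
        (A + α * y) * x     ≈⟨ solve 4 (λ A α y x → (A :+ α :* y) :* x := A :* x :+ α :* (y :* x)) refl A α y x ⟩
        A * x + α * (y * x) ∎

      ρ₀-recurrence : ρ 0 ≈ 1# + α * (y * ρ 0) + β * (y * ((q + 1#) * ρ 1))
      ρ₀-recurrence = begin
        ρ 0
          ≈⟨ x≈Ax+αyx (ρ 0) ⟩
        A * ρ 0 + α * (y * ρ 0)
          ≈⟨ +-congʳ (*-congˡ ρ₀≈γ) ⟩
        A * γ + α * (y * ρ 0)
          ≈⟨ +-congʳ Aγ≈1+cyrγ ⟩
        1# + c * y * (r * γ) + α * (y * ρ 0)
          ≈⟨ +-congʳ (+-congˡ (*-cong (*-congʳ β[q+1]≈c) (trans (ρ-suc 0) (*-congˡ ρ₀≈γ)))) ⟨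
        1# + β * (q + 1#) * y * ρ 1 + α * (y * ρ 0)
          ≈⟨ solve 6 (λ β q y ρ₀ ρ₁ α → con 1 :+ β :* (q :+ con 1) :* y :* ρ₁ :+ α :* (y :* ρ₀)
                                        := con 1 :+ α :* (y :* ρ₀) :+ β :* (y :* ((q :+ con 1) :* ρ₁)))
                   refl β q y (ρ 0) (ρ 1) α ⟩
        1# + α * (y * ρ 0) + β * (y * ((q + 1#) * ρ 1))
          ∎

      ρ-suc-recurrence : ∀ ℓ → ρ (suc ℓ) ≈ α * (y * ρ (suc ℓ)) + β * (y * (ρ ℓ + q * ρ (suc (suc ℓ))))
      ρ-suc-recurrence ℓ = begin
        ρ (suc ℓ)
          ≈⟨ x≈Ax+αyx (ρ (suc ℓ)) ⟩
        A * ρ (suc ℓ) + α * (y * ρ (suc ℓ))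
          ≈⟨ +-congʳ (*-congˡ (ρ-suc ℓ)) ⟩
        A * (r * ρ ℓ) + α * (y * ρ (suc ℓ))
          ≈⟨ +-congʳ (trans (sym (*-assoc A r (ρ ℓ))) (*-congʳ Ar≈βy[1+qr²])) ⟩
        β * y * (1# + q * (r * r)) * ρ ℓ + α * (y * ρ (suc ℓ))
          ≈⟨ solve 6 (λ β y q r ρℓ x → β :* y :* (con 1 :+ q :* (r :* r)) :* ρℓ :+ x
                                       := x :+ β :* (y :* (ρℓ :+ q :* (r :* (r :* ρℓ)))))
                   refl β y q r (ρ ℓ) (α * (y * ρ (suc ℓ))) ⟩
        α * (y * ρ (suc ℓ)) + β * (y * (ρ ℓ + q * (r * (r * ρ ℓ))))
          ≈⟨ +-congˡ (*-congˡ (*-congˡ (+-congˡ (*-congˡ (trans (ρ-suc (suc ℓ)) (*-congˡ (ρ-suc ℓ))))))) ⟨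
        α * (y * ρ (suc ℓ)) + β * (y * (ρ ℓ + q * ρ (suc (suc ℓ))))
          ∎

module _ where
  open ≡ using (refl; trans; cong)
  open import Data.Rational using (_+_; _*_; mkℚ)

  ℕtoℚ≡mkℚ : ∀ n → ℕtoℚ n ≡ mkℚ (ℤ.+ n) 0 (Coprime.sym (Coprime.1-coprimeTo n))
  ℕtoℚ≡mkℚ n = ℚ.normalize-coprime _

  ℕtoℚ-suc : ∀ n → ℕtoℚ (suc n) ≡ ℕtoℚ n + 1ℚ
  ℕtoℚ-suc n rewrite ℕtoℚ≡mkℚ n =
    cong (λ z → z ℚ./ 1)
         (≡.sym (trans (cong (ℤ._+ ℤ.+ 1) (ℤ.*-identityʳ (ℤ.+ n))) (cong ℤ.+_ (ℕ.+-comm n 1))))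

  ℕtoℚ-suc≢0 : ∀ n → ℕtoℚ (suc n) ≢ 0ℚ
  ℕtoℚ-suc≢0 n eq with trans (≡.sym (ℕtoℚ≡mkℚ (suc n))) eq
  ... | ()

  ℕtoℚ≢0 : ∀ {n} → 1 ≤ n → ℕtoℚ n ≢ 0ℚ
  ℕtoℚ≢0 {suc n} _ = ℕtoℚ-suc≢0 n

  recip-inverseˡ : ∀ x → x ≢ 0ℚ → recip x * x ≡ 1ℚ
  recip-inverseˡ x x≢0 with x ℚ.≟ 0ℚ
  ... | yes x≡0 = ⊥-elim (x≢0 x≡0)
  ... | no  x≢0′ = ℚ.*-inverseˡ x {{ℚ.≢-nonZero x≢0′}}

module ReducedWords {q : ℕ} where
  open ≡ using (refl; sym; trans; cong)

  _≢head_ : Fin (suc q) → Vertex q → Set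
  i ≢head []      = ⊤
  i ≢head (x ∷ _) = i ≢ x

  NotLast : Fin (suc q) → Vertex q → Set
  NotLast i []           = ⊤
  NotLast i (x ∷ [])     = i ≢ x
  NotLast i (x ∷ y ∷ ys) = NotLast i (y ∷ ys)

  Reduced-∷ : ∀ {x : Fin (suc q)} (ws : Vertex q) → x ≢head ws → Reduced ws → Reduced (x ∷ ws)
  Reduced-∷ []       _   _  = tt
  Reduced-∷ (y ∷ ys) x≢y rw = x≢y , rw

  Reduced-head : ∀ {x : Fin (suc q)} (ws : Vertex q) → Reduced (x ∷ ws) → x ≢head ws
  Reduced-head []       _  = tt
  Reduced-head (y ∷ ys) rw = proj₁ rw

  Reduced-tail : ∀ {x : Fin (suc q)} (ws : Vertex q) → Reduced (x ∷ ws) → Reduced ws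
  Reduced-tail []       _  = tt
  Reduced-tail (y ∷ ys) rw = proj₂ rw

  Reduced-ʳ++ : ∀ x (xs ys : Vertex q) → Reduced (x ∷ xs) → Reduced ys → x ≢head ys →
                Reduced ((x ∷ xs) ʳ++ ys)
  Reduced-ʳ++ x []       ys _  rys x≢ys = Reduced-∷ ys x≢ys rys
  Reduced-ʳ++ x (z ∷ zs) ys rx rys x≢ys =
    Reduced-ʳ++ z zs (x ∷ ys) (proj₂ rx) (Reduced-∷ ys x≢ys rys) (λ z≡x → proj₁ rx (sym z≡x))

  Reduced-reverse : ∀ (w : Vertex q) → Reduced w → Reduced (reverse w)
  Reduced-reverse []       _  = tt
  Reduced-reverse (x ∷ xs) rw = Reduced-ʳ++ x xs [] rw tt tt

  nbr-push : ∀ {i} (w : Vertex q) → i ≢head w → nbr w i ≡ i ∷ w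
  nbr-push          []       _   = refl
  nbr-push {i} (x ∷ ws) i≢x with x Fin.≟ i
  ... | yes x≡i = ⊥-elim (i≢x (sym x≡i))
  ... | no  _   = refl

  nbr-pop : ∀ i (ws : Vertex q) → nbr (i ∷ ws) i ≡ ws
  nbr-pop i ws with i Fin.≟ i
  ... | yes _   = refl
  ... | no  i≢i = ⊥-elim (i≢i refl)

  nbr-involutive : ∀ {i} (w : Vertex q) → Reduced w → nbr (nbr w i) i ≡ w
  nbr-involutive {i} []       _  = nbr-pop i []
  nbr-involutive {i} (x ∷ ws) rw with x Fin.≟ i
  ... | yes refl = nbr-push ws (Reduced-head ws rw)
  ... | no  _    = nbr-pop i (x ∷ ws)

  Reduced-nbr : ∀ {i} (w : Vertex q) → Reduced w → Reduced (nbr w i)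
  Reduced-nbr     []       _  = tt
  Reduced-nbr {i} (x ∷ ws) rw with x Fin.≟ i
  ... | yes _   = Reduced-tail ws rw
  ... | no  x≢i = (λ i≡x → x≢i (sym i≡x)) , rw

  -- For root-first words a and b, relative a b is the reduced word of a⁻¹b, stored first letter
  -- at the head; nbr acting on the head is then left multiplication by a generator.
  relative : Vertex q → Vertex q → Vertex q
  relative []       ys       = ys
  relative (x ∷ xs) []       = (x ∷ xs) ʳ++ []
  relative (x ∷ xs) (y ∷ ys) with x Fin.≟ y
  ... | yes _ = relative xs ys
  ... | no  _ = (x ∷ xs) ʳ++ (y ∷ ys)

  distW≡length-relative : ∀ (a b : Vertex q) → distW a b ≡ length (relative a b)
  distW≡length-relative []       ys       = refl
  distW≡length-relative (x ∷ xs) []       = sym (trans (List.length-ʳ++ (x ∷ xs)) (ℕ.+-identityʳ _))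
  distW≡length-relative (x ∷ xs) (y ∷ ys) with x Fin.≟ y
  ... | yes _ = distW≡length-relative xs ys
  ... | no  _ = sym (List.length-ʳ++ (x ∷ xs))

  relative-self : ∀ (a : Vertex q) → relative a a ≡ []
  relative-self []       = refl
  relative-self (x ∷ xs) with x Fin.≟ x
  ... | yes _   = relative-self xs
  ... | no  x≢x = ⊥-elim (x≢x refl)

  ʳ++-≢[] : ∀ x xs (t : Vertex q) → (x ∷ xs) ʳ++ t ≢ []
  ʳ++-≢[] x []       t ()
  ʳ++-≢[] x (z ∷ zs) t = ʳ++-≢[] z zs (x ∷ t)

  relative≡[]⇒≡ : ∀ (a b : Vertex q) → relative a b ≡ [] → a ≡ b
  relative≡[]⇒≡ []       b        eq = sym eq
  relative≡[]⇒≡ (x ∷ xs) []       eq = ⊥-elim (ʳ++-≢[] x xs [] eq)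
  relative≡[]⇒≡ (x ∷ xs) (y ∷ ys) eq with x Fin.≟ y
  ... | yes refl = cong (x ∷_) (relative≡[]⇒≡ xs ys eq)
  ... | no  _    = ⊥-elim (ʳ++-≢[] x xs (y ∷ ys) eq)

  Reduced-relative : ∀ (a b : Vertex q) → Reduced a → Reduced b → Reduced (relative a b)
  Reduced-relative []       b        _  rb = rb
  Reduced-relative (x ∷ xs) []       ra _  = Reduced-ʳ++ x xs [] ra tt tt
  Reduced-relative (x ∷ xs) (y ∷ ys) ra rb with x Fin.≟ y
  ... | yes _   = Reduced-relative xs ys (Reduced-tail xs ra) (Reduced-tail ys rb)
  ... | no  x≢y = Reduced-ʳ++ x xs (y ∷ ys) ra rb x≢y

  NotLast-tail : ∀ {i} x (xs : Vertex q) → NotLast i (x ∷ xs) → NotLast i xs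
  NotLast-tail x []       _ = tt
  NotLast-tail x (y ∷ ys) h = h

  NotLast-ʳ++ : ∀ {i} (xs : Vertex q) y ys → NotLast i (y ∷ ys) → NotLast i (xs ʳ++ y ∷ ys)
  NotLast-ʳ++ []       y ys h = h
  NotLast-ʳ++ (z ∷ zs) y ys h = NotLast-ʳ++ zs z (y ∷ ys) h

  ≢head-ʳ++ : ∀ {i} x (xs t : Vertex q) → NotLast i (x ∷ xs) → i ≢head ((x ∷ xs) ʳ++ t)
  ≢head-ʳ++ x []       t h = h
  ≢head-ʳ++ x (z ∷ zs) t h = ≢head-ʳ++ z zs (x ∷ t) h

  relative-snoc : ∀ {i} (a b : Vertex q) → NotLast i a → relative (a ∷ʳ i) b ≡ nbr (relative a b) i
  relative-snoc     []       []       _ = refl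
  relative-snoc {i} []       (y ∷ ys) _ with i Fin.≟ y
  ... | yes refl = sym (nbr-pop i ys)
  ... | no  i≢y  = sym (nbr-push (y ∷ ys) i≢y)
  relative-snoc {i} (x ∷ xs) []       h =
    trans (List.++-ʳ++ (x ∷ xs)) (sym (nbr-push ((x ∷ xs) ʳ++ []) (≢head-ʳ++ x xs [] h)))
  relative-snoc {i} (x ∷ xs) (y ∷ ys) h with x Fin.≟ y
  ... | yes _ = relative-snoc xs ys (NotLast-tail x xs h)
  ... | no  _ = trans (List.++-ʳ++ (x ∷ xs)) (sym (nbr-push ((x ∷ xs) ʳ++ y ∷ ys) (≢head-ʳ++ x xs (y ∷ ys) h)))

  relative-push : ∀ {i} (u b : Vertex q) → i ≢head u →
                  relative (reverse (i ∷ u)) b ≡ nbr (relative (reverse u) b) i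
  relative-push {i} u b i≢u =
    trans (cong (λ a → relative a b) (List.unfold-reverse i u)) (relative-snoc (reverse u) b (last≢ u i≢u))
    where
    last≢ : ∀ u → i ≢head u → NotLast i (reverse u)
    last≢ []       _   = tt
    last≢ (x ∷ ws) i≢x = NotLast-ʳ++ ws x [] i≢x

  dist-self : ∀ (u : Vertex q) → dist u u ≡ 0
  dist-self u = trans (distW≡length-relative (reverse u) (reverse u)) (cong length (relative-self (reverse u)))

  relative-nbr : ∀ {i} (u b : Vertex q) → Reduced u → Reduced b →
                 relative (reverse (nbr u i)) b ≡ nbr (relative (reverse u) b) i
  relative-nbr     []       b _  _  = relative-push [] b tt
  relative-nbr {i} (x ∷ ws) b ru rb with x Fin.≟ i
  ... | yes refl = sym (trans (cong (λ w → nbr w x) (relative-push ws b (Reduced-head ws ru)))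
                              (nbr-involutive (relative (reverse ws) b) rws))
    where
    rws : Reduced (relative (reverse ws) b)
    rws = Reduced-relative (reverse ws) b (Reduced-reverse ws (Reduced-tail ws ru)) rb
  ... | no  x≢i  = relative-push (x ∷ ws) b (λ i≡x → x≢i (sym i≡x))

module _ where
  open ≡ using (refl; sym; trans; cong; cong₂)
  open import Data.Rational using (_+_; _*_)
  open +-*-Solver using (solve; _:=_; _:+_; _:*_; con)

  sumFin-cong : ∀ m {f g : Fin m → ℚ} → (∀ i → f i ≡ g i) → sumFin m f ≡ sumFin m g
  sumFin-cong zero    f≡g = refl
  sumFin-cong (suc m) f≡g = cong₂ _+_ (f≡g Fin.zero) (sumFin-cong m (λ i → f≡g (Fin.suc i)))

  sumFin-const : ∀ m {f : Fin m → ℚ} B → (∀ i → f i ≡ B) → sumFin m f ≡ ℕtoℚ m * B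
  sumFin-const zero    B _    = sym (ℚ.*-zeroˡ B)
  sumFin-const (suc m) B f≡B = begin
    _                     ≡⟨ cong₂ _+_ (f≡B Fin.zero) (sumFin-const m B (λ i → f≡B (Fin.suc i))) ⟩
    B + ℕtoℚ m * B        ≡⟨ solve 2 (λ B m → B :+ m :* B := (m :+ con 1ℚ) :* B) refl B (ℕtoℚ m) ⟩
    (ℕtoℚ m + 1ℚ) * B     ≡⟨ cong (_* B) (ℕtoℚ-suc m) ⟨
    ℕtoℚ (suc m) * B      ∎
    where open ≡.≡-Reasoning

  sumFin-single : ∀ m (x : Fin (suc m)) {f : Fin (suc m) → ℚ} A B →
                  f x ≡ A → (∀ i → x ≢ i → f i ≡ B) → sumFin (suc m) f ≡ A + ℕtoℚ m * B
  sumFin-single m       Fin.zero    A B fx≡A f≡B =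
    cong₂ _+_ fx≡A (sumFin-const m B (λ i → f≡B (Fin.suc i) λ ()))
  sumFin-single (suc m) (Fin.suc x) A B fx≡A f≡B = begin
    _                      ≡⟨ cong₂ _+_ (f≡B Fin.zero λ ()) (sumFin-single m x A B fx≡A f≡B′) ⟩
    B + (A + ℕtoℚ m * B)   ≡⟨ solve 3 (λ A B m → B :+ (A :+ m :* B) := A :+ (m :+ con 1ℚ) :* B)
                                      refl A B (ℕtoℚ m) ⟩
    A + (ℕtoℚ m + 1ℚ) * B  ≡⟨ cong (λ t → A + t * B) (ℕtoℚ-suc m) ⟨
    A + ℕtoℚ (suc m) * B   ∎
    where
    open ≡.≡-Reasoning
    f≡B′ : ∀ i → x ≢ i → _ ≡ B
    f≡B′ i x≢i = f≡B (Fin.suc i) (λ eq → x≢i (Fin.suc-injective eq))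

module _ where
  open import Data.Rational using (_+_; _*_; _-_)

  moveProb : ℕ → ℚ → ℚ
  moveProb q α = (1ℚ - α) * recip (ℕtoℚ (suc q))

  record DistanceRecurrence (q : ℕ) (α : ℚ) (R : ℕ → ℕ → ℚ) : Set where
    field
      zero-zero : R 0 0 ≡ 1ℚ
      suc-zero  : ∀ ℓ → R (suc ℓ) 0 ≡ 0ℚ
      zero-suc  : ∀ n → R 0 (suc n) ≡ α * R 0 n + moveProb q α * (ℕtoℚ (suc q) * R 1 n)
      suc-suc   : ∀ ℓ n → R (suc ℓ) (suc n) ≡
                  α * R (suc ℓ) n + moveProb q α * (R ℓ n + ℕtoℚ q * R (suc (suc ℓ)) n)

module _ {q α R} (rec : DistanceRecurrence q α R) where
  open DistanceRecurrence rec
  open ReducedWords {q}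
  open ≡ using (refl; sym; trans; cong; cong₂)
  open import Data.Rational using (_+_; _*_)

  private
    β : ℚ
    β = moveProb q α

    R-step : ∀ n (w : Vertex q) →
             α * R (length w) n + β * sumFin (suc q) (λ i → R (length (nbr w i)) n) ≡ R (length w) (suc n)
    R-step n [] = trans (cong (λ t → α * R 0 n + β * t) (sumFin-const (suc q) (R 1 n) (λ _ → refl)))
                        (sym (zero-suc n))
    R-step n (x ∷ ws) = trans (cong (λ t → α * R (suc (length ws)) n + β * t) (sumFin-single q x _ _ pop push))
                              (sym (suc-suc (length ws) n))
      where
      pop : R (length (nbr (x ∷ ws) x)) n ≡ R (length ws) n
      pop = cong (λ w → R (length w) n) (nbr-pop x ws)
      push : ∀ i → x ≢ i → R (length (nbr (x ∷ ws) i)) n ≡ R (suc (suc (length ws))) n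
      push i x≢i = cong (λ w → R (length w) n) (nbr-push (x ∷ ws) (λ i≡x → x≢i (sym i≡x)))

    walkProb≡R-relative : ∀ {v} → Reduced v → ∀ n u → Reduced u →
                          walkProb q α u v n ≡ R (length (relative (reverse u) (reverse v))) n
    walkProb≡R-relative {v} rv zero u ru with List.≡-dec Fin._≟_ u v
    ... | yes refl = sym (trans (cong (λ w → R (length w) 0) (relative-self (reverse u))) zero-zero)
    ... | no  u≢v with relative (reverse u) (reverse v) in eq
    ...   | []     = ⊥-elim (u≢v (List.reverse-injective (relative≡[]⇒≡ (reverse u) (reverse v) eq)))
    ...   | x ∷ ws = sym (suc-zero (length ws))
    walkProb≡R-relative {v} rv (suc n) u ru = trans
      (cong₂ (λ p s → α * p + β * s) (walkProb≡R-relative rv n u ru) (sumFin-cong (suc q) λ i →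
         trans (walkProb≡R-relative rv n (nbr u i) (Reduced-nbr u ru))
               (cong (λ w → R (length w) n) (relative-nbr u (reverse v) ru (Reduced-reverse v rv)))))
      (R-step n (relative (reverse u) (reverse v)))

  walkProb≡R-dist : ∀ {u v} → Reduced u → Reduced v → ∀ n → walkProb q α u v n ≡ R (dist u v) n
  walkProb≡R-dist {u} {v} ru rv n = trans (walkProb≡R-relative rv n u ru)
    (cong (λ ℓ → R ℓ n) (sym (distW≡length-relative (reverse u) (reverse v))))

module ℚy  = PowerSeries ℚ.+-*-commutativeRing
module ℚyx = PowerSeries ℚy.seriesRing

open ℚy using (_≋_; mk≋; coeff≈)

module _ (Δ′ : ℚ[[y]]) (c : ℚ) where
  open AppendOnly 0ℚ (sqrtUpto Δ′ c) ≡.refl (λ n → _ , ≡.refl)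
  open ≡ using (refl; trans; cong; cong₂)
  open import Data.Rational using (_+_; _*_; _-_)
  open +-*-Solver using (solve; _:=_; _:+_; _:-_; _:*_; con)

  private
    s : ℚ[[y]]
    s = sqrtQ Δ′ c

  sqrtQ-suc : ∀ n → s (suc n) ≡ (Δ′ (suc n) - sum1 0ℚ _+_ n (λ k → s k * s (suc n ∸ k))) * recip (c + c)
  sqrtQ-suc n = trans (at-L-last n) (cong (λ t → (Δ′ (suc n) - t) * recip (c + c)) (sum1-cong 0ℚ _+_ n earlier))
    where
    earlier : ∀ {k} → 1 ≤ k → k ≤ n →
              at 0ℚ (sqrtUpto Δ′ c n) k * at 0ℚ (sqrtUpto Δ′ c n) (suc n ∸ k) ≡ s k * s (suc n ∸ k)
    earlier {suc k} _ k<n = cong₂ _*_ (at-L-stable k<n) (at-L-stable (ℕ.m∸n≤m n k))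

  sqrtQ-square : c * c ≡ Δ′ 0 → c + c ≢ 0ℚ → s *Q s ≋ Δ′
  sqrtQ-square c²≡Δ₀ 2c≢0 = mk≋ coeff
    where
    open ≡.≡-Reasoning
    coeff : ∀ n → (s *Q s) n ≡ Δ′ n
    coeff zero    = trans (ℚ.+-identityʳ _) c²≡Δ₀
    coeff (suc m) = begin
      c * s (suc m) + (T + s (suc m) * s (m ∸ m))
        ≡⟨ cong (λ t → c * s (suc m) + (T + s (suc m) * s t)) (ℕ.n∸n≡0 m) ⟩
      c * s (suc m) + (T + s (suc m) * c)
        ≡⟨ cong (λ t → c * t + (T + t * c)) (sqrtQ-suc m) ⟩
      c * ((Δ′ (suc m) - T) * r) + (T + ((Δ′ (suc m) - T) * r) * c)
        ≡⟨ solve 4 (λ c d t r → c :* ((d :- t) :* r) :+ (t :+ ((d :- t) :* r) :* c)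
                                := (d :- t) :* (r :* (c :+ c)) :+ t) refl c (Δ′ (suc m)) T r ⟩
      (Δ′ (suc m) - T) * (r * (c + c)) + T
        ≡⟨ cong (λ t → (Δ′ (suc m) - T) * t + T) (recip-inverseˡ (c + c) 2c≢0) ⟩
      (Δ′ (suc m) - T) * 1ℚ + T
        ≡⟨ solve 2 (λ d t → (d :- t) :* con 1ℚ :+ t := d) refl (Δ′ (suc m)) T ⟩
      Δ′ (suc m)
        ∎
      where
      T r : ℚ
      T = sum1 0ℚ _+_ m (λ k → s k * s (suc m ∸ k))
      r = recip (c + c)

module GeneratingFunctionCoefficients (q : ℕ) (α : ℚ) (1≤q : 1 ≤ q) where
  open ≡ using (refl; sym; trans; cong; cong₂)
  open import Data.Rational using (½; _+_; _*_; _-_; -_)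

  qℚ a a′ c β : ℚ
  qℚ = ℕtoℚ q
  a  = (qℚ + 1ℚ) * ½
  a′ = (qℚ - 1ℚ) * ½
  c  = 1ℚ - α
  β  = moveProb q α

  A s N D i j : ℚ[[y]]
  A = oneMinusαy α
  s = sqrtΔ q α
  N = (cst a *Q A) +Q s
  D = (cst a′ *Q A) +Q s
  i = invQ (denom q α 0)
  j = invQ D

  module Scalars where
    open +-*-Solver using (solve; _:=_; _:+_; _:-_; _:*_; :-_; con)

    A₀≡1 : A 0 ≡ 1ℚ
    A₀≡1 = solve 1 (λ α → con 1ℚ :+ :- (α :* con 0ℚ :+ con 0ℚ) := con 1ℚ) refl α

    N₀≡q+1 : N 0 ≡ qℚ + 1ℚ
    N₀≡q+1 = trans (cong (λ t → a * t + 0ℚ + a) A₀≡1)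
      (solve 1 (λ q → (q :+ con 1ℚ) :* con ½ :* con 1ℚ :+ con 0ℚ :+ (q :+ con 1ℚ) :* con ½ := q :+ con 1ℚ) refl qℚ)

    D₀≡q : D 0 ≡ qℚ
    D₀≡q = trans (cong (λ t → a′ * t + 0ℚ + a) A₀≡1)
      (solve 1 (λ q → (q :- con 1ℚ) :* con ½ :* con 1ℚ :+ con 0ℚ :+ (q :+ con 1ℚ) :* con ½ := q) refl qℚ)

    Δ₀≡a² : Δ q α 0 ≡ a * a
    Δ₀≡a² = trans (cong (λ t → (a * a) * (t * t + 0ℚ) + 0ℚ + - ((qℚ * (c * c)) * (0ℚ * 0ℚ + 0ℚ) + 0ℚ)) A₀≡1)
      (solve 2 (λ u k → u :* (con 1ℚ :* con 1ℚ :+ con 0ℚ) :+ con 0ℚ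
                        :+ :- (k :* (con 0ℚ :* con 0ℚ :+ con 0ℚ) :+ con 0ℚ) := u)
             refl (a * a) (qℚ * (c * c)))

    a+a≡q+1 : a + a ≡ qℚ + 1ℚ
    a+a≡q+1 = solve 1 (λ q → (q :+ con 1ℚ) :* con ½ :+ (q :+ con 1ℚ) :* con ½ := q :+ con 1ℚ) refl qℚ

    a′+1≡a : a′ + 1ℚ ≡ a
    a′+1≡a = solve 1 (λ q → (q :- con 1ℚ) :* con ½ :+ con 1ℚ := (q :+ con 1ℚ) :* con ½) refl qℚ

    β[q+1]≡c : β * (qℚ + 1ℚ) ≡ c
    β[q+1]≡c = begin
      c * recip (ℕtoℚ (suc q)) * (qℚ + 1ℚ)       ≡⟨ cong (c * recip (ℕtoℚ (suc q)) *_) (ℕtoℚ-suc q) ⟨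
      c * recip (ℕtoℚ (suc q)) * ℕtoℚ (suc q)    ≡⟨ ℚ.*-assoc c _ _ ⟩
      c * (recip (ℕtoℚ (suc q)) * ℕtoℚ (suc q))  ≡⟨ cong (c *_) (recip-inverseˡ _ (ℕtoℚ-suc≢0 q)) ⟩
      c * 1ℚ                                     ≡⟨ ℚ.*-identityʳ c ⟩
      c                                          ∎
      where open ≡.≡-Reasoning

  open Scalars

  private
    module ℚyR = CommutativeRing ℚy.seriesRing
  open ℚyR using (_≈_)
  open import Relation.Binary.Reasoning.Setoid ℚyR.setoid
  open import Algebra.Properties.Ring ℚyR.ring using (//-rightDividesˡ)
  open import Algebra.Solver.Ring.NaturalCoefficients.Default ℚyR.commutativeSemiring
    using (solve; _:=_; _:+_; _:*_; con)

  cst-≡ : ∀ {x y} → x ≡ y → cst x ≈ cst y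
  cst-≡ refl = ℚyR.refl

  A+αy≈1 : A +Q (cst α *Q Y) ≈ cst 1ℚ
  A+αy≈1 = //-rightDividesˡ (cst α *Q Y) (cst 1ℚ)

  a+a≈q+1 : cst a +Q cst a ≈ cst qℚ +Q cst 1ℚ
  a+a≈q+1 = begin
    cst a +Q cst a      ≈⟨ ℚy.const-+ a a ⟨
    cst (a + a)         ≈⟨ cst-≡ a+a≡q+1 ⟩
    cst (qℚ + 1ℚ)       ≈⟨ ℚy.const-+ qℚ 1ℚ ⟩
    cst qℚ +Q cst 1ℚ    ∎

  β[q+1]≈c : cst β *Q (cst qℚ +Q cst 1ℚ) ≈ cst c
  β[q+1]≈c = begin
    cst β *Q (cst qℚ +Q cst 1ℚ)  ≈⟨ ℚyR.*-congˡ {cst β} (ℚy.const-+ qℚ 1ℚ) ⟨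
    cst β *Q cst (qℚ + 1ℚ)       ≈⟨ ℚy.const-* β _ ⟨
    cst (β * (qℚ + 1ℚ))          ≈⟨ cst-≡ β[q+1]≡c ⟩
    cst c                        ∎

  s²+qc²y²≈a²A² : (s *Q s) +Q ((cst qℚ *Q (cst c *Q cst c)) *Q (Y *Q Y)) ≈ (cst a *Q cst a) *Q (A *Q A)
  s²+qc²y²≈a²A² = begin
    (s *Q s) +Q ((cst qℚ *Q (cst c *Q cst c)) *Q (Y *Q Y))
      ≈⟨ ℚyR.+-cong (sqrtQ-square (Δ q α) a (sym Δ₀≡a²) a+a≢0) (ℚyR.*-congʳ {Y *Q Y} (ℚyR.sym qc²≈)) ⟩
    Δ q α +Q (cst (qℚ * (c * c)) *Q (Y *Q Y))
      ≈⟨ //-rightDividesˡ _ _ ⟩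
    cst (a * a) *Q (A *Q A)
      ≈⟨ ℚyR.*-congʳ {A *Q A} (ℚy.const-* a a) ⟩
    (cst a *Q cst a) *Q (A *Q A)
      ∎
    where
    a+a≢0 : a + a ≢ 0ℚ
    a+a≢0 eq = ℕtoℚ-suc≢0 q (trans (ℕtoℚ-suc q) (trans (sym a+a≡q+1) eq))
    qc²≈ : cst (qℚ * (c * c)) ≈ cst qℚ *Q (cst c *Q cst c)
    qc²≈ = ℚyR.trans (ℚy.const-* qℚ _) (ℚyR.*-congˡ {cst qℚ} (ℚy.const-* c c))

  D+A≈N : D +Q A ≈ N
  D+A≈N = begin
    ((cst a′ *Q A) +Q s) +Q A
      ≈⟨ solve 3 (λ a′ A s → a′ :* A :+ s :+ A := (a′ :+ con 1) :* A :+ s) ℚyR.refl (cst a′) A s ⟩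
    ((cst a′ +Q cst 1ℚ) *Q A) +Q s
      ≈⟨ ℚyR.+-congʳ {s} (ℚyR.*-congʳ {A} (ℚyR.trans (ℚyR.sym (ℚy.const-+ a′ 1ℚ)) (cst-≡ a′+1≡a))) ⟩
    (cst a *Q A) +Q s
      ∎

  cy : ℚ[[y]]
  cy = cst c *Q Y

  den₀≈N : denom q α 0 ≈ N
  den₀≈N = ℚyx.linear-coeff₀ N cy

  iN≈1 : i *Q N ≈ cst 1ℚ
  iN≈1 = begin
    i *Q N              ≈⟨ ℚyR.*-congˡ {i} den₀≈N ⟨
    i *Q denom q α 0    ≈⟨ ℚyR.*-comm i (denom q α 0) ⟩
    denom q α 0 *Q i    ≈⟨ ℚy.*ₛ-invₛ (denom q α 0) (recip (denom q α 0 0)) (recip-inverseˡ _ den₀₀≢0) ⟩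
    cst 1ℚ              ∎
    where
    den₀₀≢0 : denom q α 0 0 ≢ 0ℚ
    den₀₀≢0 eq = ℕtoℚ-suc≢0 q (trans (ℕtoℚ-suc q) (trans (sym N₀≡q+1) (trans (sym (coeff≈ den₀≈N 0)) eq)))

  jD≈1 : j *Q D ≈ cst 1ℚ
  jD≈1 = ℚyR.trans (ℚyR.*-comm j D) (ℚy.*ₛ-invₛ D (recip (D 0)) (recip-inverseˡ _ D₀≢0))
    where
    D₀≢0 : D 0 ≢ 0ℚ
    D₀≢0 eq = ℕtoℚ≢0 1≤q (trans (sym D₀≡q) eq)

  module G = LazyWalkGeneratingFunction.Identities ℚy.seriesRing (cst qℚ) (cst a) (cst c) (cst α) (cst β) Y A s D i j
               A+αy≈1 a+a≈q+1 β[q+1]≈c s²+qc²y²≈a²A² D+A≈N iN≈1 jD≈1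

  b : ℕ → ℚ[[y]]
  b = invQQ (denom q α)

  GRHS≈γNb : ∀ ℓ → GRHS q α ℓ ≈ γRHS q α *Q (N *Q b ℓ)
  GRHS≈γNb ℓ = begin
    GRHS q α ℓ
      ≈⟨ ℚyx.coeff≈ (ℚyx.*ₛ-comm (ℚyx._*ₛ_ (numer q α) b) (ℚyx.const (γRHS q α))) ℓ ⟩
    ℚyx._*ₛ_ (ℚyx.const (γRHS q α)) (ℚyx._*ₛ_ (numer q α) b) ℓ
      ≈⟨ ℚyx.coeff-const*ₛ (γRHS q α) (ℚyx._*ₛ_ (numer q α) b) ℓ ⟩
    γRHS q α *Q ℚyx._*ₛ_ (numer q α) b ℓ
      ≈⟨ ℚyR.*-congˡ {γRHS q α} (ℚyx.coeff-const*ₛ N b ℓ) ⟩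
    γRHS q α *Q (N *Q b ℓ)
      ∎

  GRHS₀≈γ : GRHS q α 0 ≈ γRHS q α
  GRHS₀≈γ = begin
    GRHS q α 0                   ≈⟨ GRHS≈γNb 0 ⟩
    γRHS q α *Q (N *Q i)         ≈⟨ ℚyR.*-congˡ {γRHS q α} (ℚyR.trans (ℚyR.*-comm N i) iN≈1) ⟩
    γRHS q α *Q cst 1ℚ           ≈⟨ ℚyR.*-identityʳ _ ⟩
    γRHS q α                     ∎

  GRHS-suc≈rGRHS : ∀ ℓ → GRHS q α (suc ℓ) ≈ G.r *Q GRHS q α ℓ
  GRHS-suc≈rGRHS ℓ = begin
    GRHS q α (suc ℓ)                       ≈⟨ GRHS≈γNb (suc ℓ) ⟩
    γRHS q α *Q (N *Q b (suc ℓ))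
      ≈⟨ ℚyR.*-congˡ {γRHS q α} (ℚyR.*-congˡ {N} (ℚyx.invₛ-linear-suc N cy i ℓ)) ⟩
    γRHS q α *Q (N *Q (i *Q (cy *Q b ℓ)))  ≈⟨ solve 5 (λ g n i e b → g :* (n :* (i :* (e :* b)))
                                                                  := i :* e :* (g :* (n :* b)))
                                                    ℚyR.refl (γRHS q α) N i cy (b ℓ) ⟩
    (i *Q cy) *Q (γRHS q α *Q (N *Q b ℓ))  ≈⟨ ℚyR.*-congˡ {i *Q cy} (GRHS≈γNb ℓ) ⟨
    G.r *Q GRHS q α ℓ                      ∎

  private
    ρ : ℕ → ℚ[[y]]
    ρ = GRHS q α

    ρ₀-recurrence : ρ 0 ≈ (cst 1ℚ +Q (cst α *Q (Y *Q ρ 0))) +Q (cst β *Q (Y *Q ((cst qℚ +Q cst 1ℚ) *Q ρ 1)))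
    ρ₀-recurrence = G.ρ₀-recurrence ρ GRHS₀≈γ GRHS-suc≈rGRHS

    ρ-suc-recurrence : ∀ ℓ → ρ (suc ℓ) ≈
      (cst α *Q (Y *Q ρ (suc ℓ))) +Q (cst β *Q (Y *Q (ρ ℓ +Q (cst qℚ *Q ρ (2 ℕ.+ ℓ)))))
    ρ-suc-recurrence = G.ρ-suc-recurrence ρ GRHS₀≈γ GRHS-suc≈rGRHS

    coeff-cst*Y*-zero : ∀ x g → (cst x *Q (Y *Q g)) 0 ≡ 0ℚ
    coeff-cst*Y*-zero x g =
      trans (ℚy.coeff-const*ₛ x (Y *Q g) 0) (trans (cong (x *_) (ℚy.coeff-X*ₛ-zero g)) (ℚ.*-zeroʳ x))

    coeff-cst*Y*-suc : ∀ x g n → (cst x *Q (Y *Q g)) (suc n) ≡ x * g n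
    coeff-cst*Y*-suc x g n = trans (ℚy.coeff-const*ₛ x (Y *Q g) (suc n)) (cong (x *_) (ℚy.coeff-X*ₛ-suc g n))

    coeff-[q+1]* : ∀ g n → ((cst qℚ +Q cst 1ℚ) *Q g) n ≡ ℕtoℚ (suc q) * g n
    coeff-[q+1]* g n = trans (coeff≈ (ℚyR.*-congʳ {g} (ℚyR.sym (ℚy.const-+ qℚ 1ℚ))) n)
                             (trans (ℚy.coeff-const*ₛ (qℚ + 1ℚ) g n) (cong (_* g n) (sym (ℕtoℚ-suc q))))

  distanceRecurrence : DistanceRecurrence q α (coeffGRHS q α)
  distanceRecurrence = record
    { zero-zero = trans (coeff≈ ρ₀-recurrence 0)
        (cong₂ (λ u w → 1ℚ + u + w) (coeff-cst*Y*-zero α (ρ 0)) (coeff-cst*Y*-zero β ((cst qℚ +Q cst 1ℚ) *Q ρ 1)))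
    ; suc-zero  = λ ℓ → trans (coeff≈ (ρ-suc-recurrence ℓ) 0)
        (cong₂ _+_ (coeff-cst*Y*-zero α (ρ (suc ℓ))) (coeff-cst*Y*-zero β (ρ ℓ +Q (cst qℚ *Q ρ (2 ℕ.+ ℓ)))))
    ; zero-suc  = λ n → trans (coeff≈ ρ₀-recurrence (suc n))
        (cong₂ _+_ (trans (ℚ.+-identityˡ _) (coeff-cst*Y*-suc α (ρ 0) n))
                   (trans (coeff-cst*Y*-suc β ((cst qℚ +Q cst 1ℚ) *Q ρ 1) n) (cong (β *_) (coeff-[q+1]* (ρ 1) n))))
    ; suc-suc   = λ ℓ n → trans (coeff≈ (ρ-suc-recurrence ℓ) (suc n))
        (cong₂ _+_ (coeff-cst*Y*-suc α (ρ (suc ℓ)) n)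
                   (trans (coeff-cst*Y*-suc β (ρ ℓ +Q (cst qℚ *Q ρ (2 ℕ.+ ℓ))) n)
                          (cong (λ t → β * (ρ ℓ n + t)) (ℚy.coeff-const*ₛ qℚ (ρ (2 ℕ.+ ℓ)) n))))
    }

theorem7p7 : (q : ℕ) → 2 ≤ q → (α : ℚ) → 0ℚ ≤ℚ α → α <ℚ 1ℚ →
    ((u : Vertex q) → Reduced u → (n : ℕ) →
       walkProb q α u u n ≡ γRHS q α n)
    × ((u v : Vertex q) → Reduced u → Reduced v → (n : ℕ) →
       walkProb q α u v n ≡ coeffGRHS q α (dist u v) n)
theorem7p7 q 2≤q α _ _ = walk-at-origin , walk-to
  where
  open GeneratingFunctionCoefficients q α (ℕ.<⇒≤ 2≤q) using (distanceRecurrence; GRHS₀≈γ)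

  walk-to : ∀ u v → Reduced u → Reduced v → ∀ n → walkProb q α u v n ≡ coeffGRHS q α (dist u v) n
  walk-to u v ru rv = walkProb≡R-dist distanceRecurrence ru rv

  walk-at-origin : ∀ u → Reduced u → ∀ n → walkProb q α u u n ≡ γRHS q α n
  walk-at-origin u ru n = begin
    walkProb q α u u n                 ≡⟨ walk-to u u ru ru n ⟩
    coeffGRHS q α (dist u u) n         ≡⟨ ≡.cong (λ ℓ → coeffGRHS q α ℓ n) (ReducedWords.dist-self u) ⟩
    coeffGRHS q α 0 n                  ≡⟨ coeff≈ GRHS₀≈γ n ⟩
    γRHS q α n                         ∎
    where open ≡.≡-Reasoning
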